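{- There exists a PTRS $\mathcal R$ such that $\mathcal R$ is iAST (and even AST), but the DP problem $(\mathcal{DT}(\mathcal R),\mathcal R)$ is not iAST.
   Context: A PTRS is a finite set of rules $\ell\to\{p_1:r_1,\dots,p_k:r_k\}$; (i)AST of $\mathcal R$ means every infinite (innermost) rewrite sequence on multi-distributions reaches normal forms with probability tending to $1$. $\mathcal{DT}(\mathcal R)$ contains for each rule $\ell\to\{p_1:r_1,\dots,p_k:r_k\}$ the coupled tuple $\langle\ell^\#,\ell\rangle\to\{p_1:\langle dp(r_1),r_1\rangle,\dots,p_k:\langle dp(r_k),r_k\rangle\}$, where $dp(r)=\mathtt c_n(t_1^\#,\dots,t_n^\#)$ collects (as a multiset, with compound constructor $\mathtt c_n$) all subterms of $r$ with defined root, root-marked by tuple symbols. $(\mathcal P,\mathcal S)$ is iAST if every $(\mathcal P,\mathcal S)$-chain tree has total leaf probability $1$, where a chain tree is a finitely branching probability-labelled tree (root probability $1$) whose inner nodes in a set $P$ perform innermost $\to^{\mathsf i}_{\mathcal P,\mathcal S}$-steps (rewrite an argument $s_i=\ell^\#\sigma\in\mathtt{NF}_{\mathcal S}$ of a normalized compound term to $dp$-part $d_j\sigma$, optionally rewriting other arguments at redexes $\ell\sigma$ uniformly to $r_j\sigma$ if the rule is in $\mathcal S$) and other inner nodes innermost $\to^{\mathsf i}_{\mathcal S}$-steps (both triangle-headed arrows in the paper), with infinitely many $P$-nodes on every infinite path. -}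

module Defs where

open import Data.Nat using (ℕ; zero; suc) renaming (_≤_ to _≤ℕ_; _<_ to _<ℕ_)
open import Data.Fin using (Fin; toℕ; _≟_)
open import Data.Rational using (ℚ; 0ℚ; 1ℚ; _+_; _*_; _-_; _<_; ∣_∣)
open import Data.List using (List; []; _∷_; _++_; map; foldr; length; upTo)
open import Data.Bool.ListAction using (any)
open import Data.Empty using (⊥)
open import Data.Unit using (⊤)
open import Data.List.Relation.Unary.All using (All)
open import Data.List.Relation.Binary.Pointwise using (Pointwise)
open import Data.List.Membership.Propositional using (_∈_)
open import Data.Vec using (Vec; lookup; _[_]≔_; fromList; toList)
import Data.Vec as V
open import Data.Product using (Σ; ∃; ∃₂; _×_; _,_; proj₁; proj₂)
open import Data.Maybe using (Maybe; just; nothing)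
open import Data.Bool using (Bool; true; false; if_then_else_)
open import Relation.Nullary using (¬_; does)
open import Relation.Binary.PropositionalEquality using (_≡_; _≢_)

module Generic {Sym : Set} (ar : Sym → ℕ) where

  data Term : Set where
    var : ℕ → Term
    fun : (f : Sym) → Vec Term (ar f) → Term

  Subst : Set
  Subst = ℕ → Term

  mutual
    _⟨_⟩ : Term → Subst → Term
    var x ⟨ σ ⟩ = σ x
    fun f ts ⟨ σ ⟩ = fun f (ts ⟨ σ ⟩*)

    _⟨_⟩* : ∀ {k} → Vec Term k → Subst → Vec Term k
    Vec.[] ⟨ σ ⟩* = Vec.[]
    (t Vec.∷ ts) ⟨ σ ⟩* = (t ⟨ σ ⟩) Vec.∷ (ts ⟨ σ ⟩*)

  data _∈vars_ (x : ℕ) : Term → Set where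
    here : x ∈vars var x
    arg  : ∀ {f ts} (i : Fin (ar f)) → x ∈vars lookup ts i → x ∈vars fun f ts

  data SubAt : Term → List ℕ → Term → Set where
    here : ∀ {t} → SubAt t [] t
    arg  : ∀ {f ts π s} (i : Fin (ar f)) → SubAt (lookup ts i) π s →
           SubAt (fun f ts) (toℕ i ∷ π) s

  -- Replace t π u t' : t' = t[u]_π  (π a position of t)
  data Replace : Term → List ℕ → Term → Term → Set where
    here : ∀ {t u} → Replace t [] u u
    arg  : ∀ {f ts π u t'} (i : Fin (ar f)) → Replace (lookup ts i) π u t' →
           Replace (fun f ts) (toℕ i ∷ π) u (fun f (ts [ i ]≔ t'))

  MDist : Set
  MDist = List (ℚ × Term)

  sumℚ : List ℚ → ℚ
  sumℚ = foldr _+_ 0ℚ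

  record Rule : Set where
    constructor _⇒_
    field
      lhs : Term
      rhs : List (ℚ × Term)
  open Rule public

  record WFRule (ρ : Rule) : Set where
    field
      lhsNotVar : ∃₂ λ f ts → lhs ρ ≡ fun f ts
      rhsNonEmpty : rhs ρ ≢ []
      probPos : All (λ pr → 0ℚ < proj₁ pr) (rhs ρ)
      probSum : sumℚ (map proj₁ (rhs ρ)) ≡ 1ℚ
      varCond : All (λ pr → ∀ x → x ∈vars proj₂ pr → x ∈vars lhs ρ) (rhs ρ)

  StepRes : Term → List ℕ → Subst → ℚ × Term → ℚ × Term → Set
  StepRes t π σ (p , r) (q , u) = q ≡ p × Replace t π (r ⟨ σ ⟩) u

  record Step (R : List Rule) (t : Term) (μ : MDist) : Set where
    field
      ρ : Rule
      ρ∈R : ρ ∈ R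
      σ : Subst
      π : List ℕ
      redex : SubAt t π (lhs ρ ⟨ σ ⟩)
      result : Pointwise (StepRes t π σ) (rhs ρ) μ

  NF : List Rule → Term → Set
  NF R t = ∀ μ → ¬ Step R t μ

  IStep : List Rule → Term → MDist → Set
  IStep R t μ = Σ (Step R t μ) λ st →
    ∀ π s → SubAt (lhs (Step.ρ st) ⟨ Step.σ st ⟩) π s → π ≢ [] → NF R s

  scale : ℚ → MDist → MDist
  scale p = map (λ qu → (p * proj₁ qu , proj₂ qu))

  data Lift (step : Term → MDist → Set) (nf : Term → Set) : MDist → MDist → Set where
    []   : Lift step nf [] []
    keep : ∀ {p t μ μ'} → nf t → Lift step nf μ μ' →
           Lift step nf ((p , t) ∷ μ) ((p , t) ∷ μ')
    rewr : ∀ {p t ν μ μ'} → step t ν → Lift step nf μ μ' →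
           Lift step nf ((p , t) ∷ μ) (scale p ν ++ μ')

  data NFMass (nf : Term → Set) : MDist → ℚ → Set where
    []  : NFMass nf [] 0ℚ
    yes : ∀ {p t μ x} → nf t → NFMass nf μ x → NFMass nf ((p , t) ∷ μ) (p + x)
    no  : ∀ {p t μ x} → ¬ nf t → NFMass nf μ x → NFMass nf ((p , t) ∷ μ) x

  ASTwrt : (Term → MDist → Set) → (Term → Set) → Set
  ASTwrt step nf =
    (μs : ℕ → MDist) (t : Term) → μs 0 ≡ (1ℚ , t) ∷ [] →
    (∀ n → Lift step nf (μs n) (μs (suc n))) →
    ∀ ε → 0ℚ < ε → Σ ℕ λ N → ∀ n → N ≤ℕ n →
      ∀ x → NFMass nf (μs n) x → ∣ x - 1ℚ ∣ < ε

record Signature : Set where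
  field
    nsym  : ℕ
    arity : Fin nsym → ℕ
open Signature public

record PTRS (Σ' : Signature) : Set where
  open Generic (arity Σ')
  field
    rules : List Rule
    wf    : All WFRule rules

module _ {Σ' : Signature} where
  open Generic (arity Σ')

  AST : PTRS Σ' → Set
  AST R = ASTwrt (Step (PTRS.rules R)) (NF (PTRS.rules R))

  iAST : PTRS Σ' → Set
  iAST R = ASTwrt (IStep (PTRS.rules R)) (NF (PTRS.rules R))

-- Extended signature: original symbols, tuple symbols f♯, compound
-- constructors cₙ (arity n).

data Sym⁺ (n : ℕ) : Set where
  orig  : Fin n → Sym⁺ n
  sharp : Fin n → Sym⁺ n
  comp  : ℕ → Sym⁺ n

ar⁺ : ∀ {n} → (Fin n → ℕ) → Sym⁺ n → ℕ
ar⁺ ar (orig f) = ar f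
ar⁺ ar (sharp f) = ar f
ar⁺ ar (comp k) = k

module Extended (Σ' : Signature) where
  module O = Generic (arity Σ')
  open Generic (ar⁺ (arity Σ')) public

  mkComp : List Term → Term
  mkComp l = fun (comp (length l)) (fromList l)

  flat : Term → List Term
  flat (fun (comp k) ts) = toList ts
  flat t = t ∷ []

  NotComp : Term → Set
  NotComp (fun (comp k) ts) = ⊥
  NotComp _ = ⊤

  mutual
    emb : O.Term → Term
    emb (O.var x) = var x
    emb (O.fun f ts) = fun (orig f) (embV ts)

    embV : ∀ {k} → Vec O.Term k → Vec Term k
    embV Vec.[] = Vec.[]
    embV (t Vec.∷ ts) = emb t Vec.∷ embV ts

  mark : O.Term → Term
  mark (O.var x) = var x
  mark (O.fun f ts) = fun (sharp f) (embV ts)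

  embRule : O.Rule → Rule
  embRule ρ = emb (O.lhs ρ) ⇒ map (λ pr → (proj₁ pr , emb (proj₂ pr))) (O.rhs ρ)

  rootIs : Fin (nsym Σ') → O.Term → Bool
  rootIs f (O.var x) = false
  rootIs f (O.fun g ts) = does (f ≟ g)

  isDefined : List O.Rule → Fin (nsym Σ') → Bool
  isDefined R f = any (λ ρ → rootIs f (O.lhs ρ)) R

  mutual
    dpl : List O.Rule → O.Term → List Term
    dpl R (O.var x) = []
    dpl R (O.fun f ts) =
      (if isDefined R f then fun (sharp f) (embV ts) ∷ [] else []) ++ dplV R ts

    dplV : ∀ {k} → List O.Rule → Vec O.Term k → List Term
    dplV R Vec.[] = []
    dplV R (t Vec.∷ ts) = dpl R t ++ dplV R ts

  dp : List O.Rule → O.Term → Term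
  dp R r = mkComp (dpl R r)

  -- coupled tuples ⟨ℓ♯,ℓ⟩ → {p₁:⟨d₁,r₁⟩, …}
  record CTuple : Set where
    constructor ctuple
    field
      lhs♯ : Term
      lhsR : Term
      crhs : List (ℚ × Term × Term)
  open CTuple public

  ruleOf : CTuple → Rule
  ruleOf κ = lhsR κ ⇒ map (λ pdr → (proj₁ pdr , proj₂ (proj₂ pdr))) (crhs κ)

  DT : PTRS Σ' → List CTuple
  DT R = map toCT (PTRS.rules R)
    where
    toCT : O.Rule → CTuple
    toCT ρ = ctuple (mark (O.lhs ρ)) (emb (O.lhs ρ))
      (map (λ pr → (proj₁ pr , dp (PTRS.rules R) (proj₂ pr) , emb (proj₂ pr))) (O.rhs ρ))

  embPTRS : PTRS Σ' → List Rule
  embPTRS R = map embRule (PTRS.rules R)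

  -- treatment of a non-selected argument sₕ in a (P,S)-step, for result j
  -- (r = rⱼ): either unchanged, or the redex ℓσ at position τ is rewritten to rⱼσ
  -- (only allowed if the rule ℓ → {p₁:r₁,…} is in S); τ is the same for all j.
  ArgOut : List Rule → CTuple → Subst → Term → Maybe (List ℕ) × Term → Term → Set
  ArgOut S κ σ r (nothing , sh) o = o ≡ sh
  ArgOut S κ σ r (just τ , sh) o =
    ruleOf κ ∈ S × SubAt sh τ (lhsR κ ⟨ σ ⟩) × Replace sh τ (r ⟨ σ ⟩) o

  PRes : List Rule → CTuple → Subst → (before after : List (Maybe (List ℕ) × Term)) →
         ℚ × Term × Term → ℚ × Term → Set
  PRes S κ σ before after (p , d , r) (q , u) =
    q ≡ p × Σ (List Term) λ bs → Σ (List Term) λ as →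
      Pointwise (ArgOut S κ σ r) before bs × Pointwise (ArgOut S κ σ r) after as ×
      u ≡ mkComp (bs ++ flat (d ⟨ σ ⟩) ++ as)

  record PStep (P : List CTuple) (S : List Rule) (t : Term) (μ : MDist) : Set where
    field
      κ : CTuple
      κ∈P : κ ∈ P
      σ : Subst
      before after : List (Maybe (List ℕ) × Term)
      s : Term
      shape : t ≡ mkComp (map proj₂ before ++ s ∷ map proj₂ after)
      normalized : All NotComp (map proj₂ before ++ s ∷ map proj₂ after)
      sel : s ≡ lhs♯ κ ⟨ σ ⟩
      selNF : NF S s
      result : Pointwise (PRes S κ σ before after) (crhs κ) μ

  -- tree addresses: child i of node a is (i ∷ a)
  data Valid (deg : List ℕ → ℕ) : List ℕ → Set where
    root  : Valid deg []
    child : ∀ {a i} → Valid deg a → i <ℕ deg a → Valid deg (i ∷ a)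

  ChildOK : ℚ → ℚ × Term → ℚ × Term → Set
  ChildOK pa (q , u) (pc , tc) = pc ≡ pa * q × tc ≡ u

  NodeOK : List CTuple → List Rule → (deg : List ℕ → ℕ) (prob : List ℕ → ℚ)
           (term : List ℕ → Term) (inP : List ℕ → Bool) → List ℕ → Set
  NodeOK P S deg prob term inP a =
    Σ MDist λ μ →
      (if inP a then PStep P S (term a) μ else IStep S (term a) μ) ×
      Pointwise (ChildOK (prob a)) μ
        (map (λ i → (prob (i ∷ a) , term (i ∷ a))) (upTo (deg a)))

  record ChainTree (P : List CTuple) (S : List Rule) : Set where
    field
      deg  : List ℕ → ℕ
      prob : List ℕ → ℚ
      term : List ℕ → Term
      inP  : List ℕ → Bool
      rootProb : prob [] ≡ 1ℚ
      inner : ∀ a → Valid deg a → 0 <ℕ deg a → NodeOK P S deg prob term inP a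
      infP  : (f : ℕ → List ℕ) → f 0 ≡ [] →
              (∀ m → Σ ℕ λ i → i <ℕ deg (f m) × f (suc m) ≡ i ∷ f m) →
              ∀ m → Σ ℕ λ m' → m ≤ℕ m' × inP (f m') ≡ true

  -- sum of probabilities of leaves of depth ≤ d below address a
  leafSumAux : (deg : List ℕ → ℕ) (prob : List ℕ → ℚ) → ℕ → List ℕ → ℕ → ℚ
  leafSumAux deg prob d a zero = prob a
  leafSumAux deg prob zero a (suc k) = 0ℚ
  leafSumAux deg prob (suc d) a (suc k) =
    sumℚ (map (λ i → leafSumAux deg prob d (i ∷ a) (deg (i ∷ a))) (upTo (suc k)))

  leafSum : ∀ {P S} → ChainTree P S → ℕ → ℚ
  leafSum T d = leafSumAux (ChainTree.deg T) (ChainTree.prob T) d [] (ChainTree.deg T [])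

  -- (P,S) is iAST: every chain tree has |T|_Leaf = 1 (limit of depth-bounded sums)
  iAST-DP : List CTuple → List Rule → Set
  iAST-DP P S = (T : ChainTree P S) →
    ∀ ε → 0ℚ < ε → Σ ℕ λ N → ∀ d → N ≤ℕ d → ∣ leafSum T d - 1ℚ ∣ < ε

-- The PTRS R₀ has the rules f → {⅔ : p(g), ⅓ : d}, g → {1 : f}, g → {1 : b} and p(b) → {1 : f}.
--
-- R₀ is AST because it has a rank into ℕ whose expectation drops by at least 1 in every rewrite
-- step.  Since normal forms are never rewritten again, the probability mass rewritten at step n
-- is non-increasing in n, and the expected rank drops by at least that mass in each step; hence
-- after n steps at most rank(t)/n of the mass has not yet reached a normal form.
--
-- In the dependency tuple of f, the term p(g) contributes both p♯(g) and g♯, and these two copies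
-- of g evolve independently: rewrite g to b inside p♯(g) with the ordinary rule, then apply the
-- tuples of p(b) and of g, which each produce an f♯.  So one f♯ becomes two with probability ⅔
-- and none with probability ⅓; starting from one f♯, this random walk reaches the empty tuple
-- (a leaf of the chain tree) only with probability ½.

module Submission where

open import Defs
open import Function using (_∘_)
open import Data.Nat
  using (ℕ; zero; suc; z≤n; s≤s)
  renaming (_≤_ to _≤ℕ_; _<_ to _<ℕ_; _+_ to _+ℕ_; _*_ to _*ℕ_)
import Data.Nat.Properties as ℕ
import Data.Nat.Coprimality as Coprime
open import Data.Fin using (Fin; zero; suc)
import Data.Integer as ℤ
import Data.Integer.Properties as ℤ
open import Data.Rational
  using ( ℚ; mkℚ; 0ℚ; 1ℚ; ½; _+_; _*_; _-_; -_; _<_; _≤_; ∣_∣; _/_; _≤?_; _<?_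
        ; *≤*; positive; nonNegative)
open import Data.Rational.Properties
import Data.Rational.Unnormalised as ℚᵘ
import Data.Rational.Unnormalised.Properties as ℚᵘ
open import Data.Rational.Solver using (module +-*-Solver)
open import Data.List using (List; []; _∷_; _++_; map; upTo; replicate)
open import Data.List.Properties using (map-cong)
open import Data.List.Relation.Unary.All as All using (All; []; _∷_)
import Data.List.Relation.Unary.All.Properties as All
open import Data.List.Relation.Unary.Any using (here; there)
open import Data.List.Relation.Binary.Pointwise using (Pointwise; []; _∷_)
open import Data.List.Membership.Propositional using (_∈_)
open import Data.Vec using ([]; _∷_)
open import Data.Maybe using (Maybe; nothing)
open import Data.Bool using (Bool; true; false; if_then_else_)
open import Data.Product using (Σ; ∃; _×_; _,_; proj₁; proj₂; map₂)
open import Data.Empty using (⊥-elim)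
open import Data.Unit using (tt)
open import Relation.Binary.PropositionalEquality
open import Relation.Nullary using (¬_)
open import Relation.Nullary.Decidable using (True; toWitness)

open +-*-Solver

-- Rational arithmetic

≤-by-computation : ∀ {p q} {p≤q : True (p ≤? q)} → p ≤ q
≤-by-computation {p≤q = p≤q} = toWitness p≤q

<-by-computation : ∀ {p q} {p<q : True (p <? q)} → p < q
<-by-computation {p<q = p<q} = toWitness p<q

*-nonNeg : ∀ {p q} → 0ℚ ≤ p → 0ℚ ≤ q → 0ℚ ≤ p * q
*-nonNeg {p} {q} 0≤p 0≤q =
  nonNegative⁻¹ _ {{nonNeg*nonNeg⇒nonNeg p {{nonNegative 0≤p}} q {{nonNegative 0≤q}}}}

p≤∣p∣ : ∀ p → p ≤ ∣ p ∣
p≤∣p∣ (mkℚ (ℤ.+ _) _ _) = ≤-refl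
p≤∣p∣ (mkℚ ℤ.-[1+ _ ] _ _) = *≤* ℤ.-≤+

fromℕ : ℕ → ℚ
fromℕ zero = 0ℚ
fromℕ (suc n) = 1ℚ + fromℕ n

fromℕ≡mkℚ : ∀ n → fromℕ n ≡ mkℚ (ℤ.+ n) 0 (Coprime.sym (Coprime.1-coprimeTo n))
fromℕ≡mkℚ zero = refl
fromℕ≡mkℚ (suc n) rewrite fromℕ≡mkℚ n =
  trans (cong (λ z → (ℤ.+ 1 ℤ.+ z) / 1) (ℤ.*-identityʳ (ℤ.+ n))) (normalize-coprime _)

fromℕ-nonNeg : ∀ n → 0ℚ ≤ fromℕ n
fromℕ-nonNeg zero = ≤-refl
fromℕ-nonNeg (suc n) = +-mono-≤ {0ℚ} {1ℚ} ≤-by-computation (fromℕ-nonNeg n)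

fromℕ-mono-≤ : ∀ {m n} → m ≤ℕ n → fromℕ m ≤ fromℕ n
fromℕ-mono-≤ {n = n} z≤n = fromℕ-nonNeg n
fromℕ-mono-≤ (s≤s m≤n) = +-monoʳ-≤ 1ℚ (fromℕ-mono-≤ m≤n)

archimedean : ∀ ε → 0ℚ < ε → ∀ B → ∃ λ N → fromℕ B < fromℕ N * ε
archimedean (mkℚ (ℤ.+ zero) _ _) 0<ε B with () ← positive 0<ε
archimedean (mkℚ ℤ.-[1+ _ ] _ _) 0<ε B with () ← positive 0<ε
archimedean ε@(mkℚ (ℤ.+ suc k) d _) _ B = N , B<N*ε
  where
  N = suc (B *ℕ suc d)
  N/1 = mkℚ (ℤ.+ N) 0 (Coprime.sym (Coprime.1-coprimeTo N))
  cross : ℤ.+ B ℤ.* ℤ.+ (1 *ℕ suc d) ℤ.< (ℤ.+ N ℤ.* ℤ.+ suc k) ℤ.* ℤ.+ 1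
  cross = subst₂ ℤ._<_
    (trans (ℤ.pos-* B (suc d)) (cong (λ m → ℤ.+ B ℤ.* ℤ.+ m) (sym (ℕ.*-identityˡ (suc d)))))
    (trans (ℤ.pos-* N (suc k)) (sym (ℤ.*-identityʳ _)))
    (ℤ.+<+ (ℕ.<-≤-trans (ℕ.n<1+n _) (ℕ.m≤m*n N (suc k))))
  B<N*ε : fromℕ B < fromℕ N * ε
  B<N*ε rewrite fromℕ≡mkℚ B | fromℕ≡mkℚ N =
    toℚᵘ-cancel-< (ℚᵘ.<-respʳ-≃ (ℚᵘ.≃-sym (toℚᵘ-homo-* N/1 ε)) (ℚᵘ.*<* cross))

n*x≤C⇒eventually-x<ε : ∀ (x : ℕ → ℚ) C → (∀ n → fromℕ n * x n ≤ fromℕ C) →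
                        ∀ ε → 0ℚ < ε → ∃ λ N → ∀ n → N ≤ℕ n → x n < ε
n*x≤C⇒eventually-x<ε x C n*x≤C ε 0<ε = N , x<ε
  where
  N = proj₁ (archimedean ε 0<ε C)
  x<ε : ∀ n → N ≤ℕ n → x n < ε
  x<ε n N≤n = *-cancelˡ-<-nonNeg (fromℕ n) {{nonNegative (fromℕ-nonNeg n)}} (begin-strict
    fromℕ n * x n  ≤⟨ n*x≤C n ⟩
    fromℕ C        <⟨ proj₂ (archimedean ε 0<ε C) ⟩
    fromℕ N * ε    ≤⟨ *-monoʳ-≤-nonNeg ε {{nonNegative (<⇒≤ 0<ε)}} (fromℕ-mono-≤ N≤n) ⟩
    fromℕ n * ε    ∎)
    where open ≤-Reasoning

-- Ranking functions

module _ {Sym : Set} {ar : Sym → ℕ} where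
  open Generic ar

  mass : MDist → ℚ
  mass [] = 0ℚ
  mass ((q , _) ∷ μ) = q + mass μ

  expectation : (Term → ℚ) → MDist → ℚ
  expectation f [] = 0ℚ
  expectation f ((q , u) ∷ μ) = q * f u + expectation f μ

  NonNeg : MDist → Set
  NonNeg = All (λ qu → 0ℚ ≤ proj₁ qu)

  mass-++ : ∀ μ ν → mass (μ ++ ν) ≡ mass μ + mass ν
  mass-++ [] ν = sym (+-identityˡ _)
  mass-++ ((q , _) ∷ μ) ν = trans (cong (q +_) (mass-++ μ ν)) (sym (+-assoc q _ _))

  mass-scale : ∀ p μ → mass (scale p μ) ≡ p * mass μ
  mass-scale p [] = sym (*-zeroʳ p)
  mass-scale p ((q , _) ∷ μ) =
    trans (cong (p * q +_) (mass-scale p μ)) (sym (*-distribˡ-+ p q _))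

  expectation-++ : ∀ f μ ν → expectation f (μ ++ ν) ≡ expectation f μ + expectation f ν
  expectation-++ f [] ν = sym (+-identityˡ _)
  expectation-++ f ((q , u) ∷ μ) ν =
    trans (cong (q * f u +_) (expectation-++ f μ ν)) (sym (+-assoc (q * f u) _ _))

  expectation-scale : ∀ f p μ → expectation f (scale p μ) ≡ p * expectation f μ
  expectation-scale f p [] = sym (*-zeroʳ p)
  expectation-scale f p ((q , u) ∷ μ) = trans (cong (p * q * f u +_) (expectation-scale f p μ))
    (solve 4 (λ p q y e → p :* q :* y :+ p :* e := p :* (q :* y :+ e)) refl p q (f u) (expectation f μ))

  expectation-nonNeg : ∀ {f} → (∀ u → 0ℚ ≤ f u) → ∀ {μ} → NonNeg μ → 0ℚ ≤ expectation f μ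
  expectation-nonNeg f≥0 [] = ≤-refl
  expectation-nonNeg f≥0 {(_ , u) ∷ _} (0≤q ∷ nn) =
    +-mono-≤ (*-nonNeg 0≤q (f≥0 u)) (expectation-nonNeg f≥0 nn)

  NonNeg-scale : ∀ {p} → 0ℚ ≤ p → ∀ {μ} → NonNeg μ → NonNeg (scale p μ)
  NonNeg-scale 0≤p [] = []
  NonNeg-scale 0≤p (0≤q ∷ nn) = *-nonNeg 0≤p 0≤q ∷ NonNeg-scale 0≤p nn

  mass-StepRes : ∀ {t π σ rs μ} → Pointwise (StepRes t π σ) rs μ → mass μ ≡ sumℚ (map proj₁ rs)
  mass-StepRes [] = refl
  mass-StepRes {rs = (p , _) ∷ _} ((refl , _) ∷ res) = cong (p +_) (mass-StepRes res)

  NonNeg-StepRes : ∀ {t π σ rs μ} → All (λ pr → 0ℚ < proj₁ pr) rs →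
                   Pointwise (StepRes t π σ) rs μ → NonNeg μ
  NonNeg-StepRes [] [] = []
  NonNeg-StepRes (0<p ∷ pos) ((refl , _) ∷ res) = <⇒≤ 0<p ∷ NonNeg-StepRes pos res

  Step-mass : ∀ {R t μ} → All WFRule R → Step R t μ → mass μ ≡ 1ℚ
  Step-mass wf st = trans (mass-StepRes result) (WFRule.probSum (All.lookup wf ρ∈R))
    where open Step st

  Step-nonNeg : ∀ {R t μ} → All WFRule R → Step R t μ → NonNeg μ
  Step-nonNeg wf st = NonNeg-StepRes (WFRule.probPos (All.lookup wf ρ∈R)) result
    where open Step st

  module _ {step : Term → MDist → Set} {nf : Term → Set} where

    rewrittenMass : ∀ {μ μ′} → Lift step nf μ μ′ → ℚ
    rewrittenMass [] = 0ℚ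
    rewrittenMass (keep _ L) = rewrittenMass L
    rewrittenMass (rewr {p = p} _ L) = p + rewrittenMass L

    rewrittenMass-nonNeg : ∀ {μ μ′} → NonNeg μ → (L : Lift step nf μ μ′) → 0ℚ ≤ rewrittenMass L
    rewrittenMass-nonNeg nn [] = ≤-refl
    rewrittenMass-nonNeg (_ ∷ nn) (keep _ L) = rewrittenMass-nonNeg nn L
    rewrittenMass-nonNeg (0≤p ∷ nn) (rewr _ L) = +-mono-≤ 0≤p (rewrittenMass-nonNeg nn L)

    rewrittenMass≤mass : ∀ {μ μ′} → NonNeg μ → (L : Lift step nf μ μ′) → rewrittenMass L ≤ mass μ
    rewrittenMass≤mass nn [] = ≤-refl
    rewrittenMass≤mass (0≤p ∷ nn) (keep {p = p} {μ = μ} _ L) = begin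
      rewrittenMass L   ≤⟨ rewrittenMass≤mass nn L ⟩
      mass μ            ≡⟨ +-identityˡ (mass μ) ⟨
      0ℚ + mass μ       ≤⟨ +-monoˡ-≤ (mass μ) 0≤p ⟩
      p + mass μ        ∎
      where open ≤-Reasoning
    rewrittenMass≤mass (_ ∷ nn) (rewr {p = p} _ L) = +-monoʳ-≤ p (rewrittenMass≤mass nn L)

    Lift-++ : ∀ μ {ν ρ} (L : Lift step nf (μ ++ ν) ρ) →
              Σ MDist λ μ′ → Σ MDist λ ν′ → Σ (Lift step nf μ μ′) λ Lμ →
                Σ (Lift step nf ν ν′) λ Lν → rewrittenMass L ≡ rewrittenMass Lμ + rewrittenMass Lν
    Lift-++ [] L = _ , _ , [] , L , sym (+-identityˡ _)
    Lift-++ (_ ∷ μ) (keep n L) with Lift-++ μ L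
    ... | _ , _ , Lμ , Lν , eq = _ , _ , keep n Lμ , Lν , eq
    Lift-++ (_ ∷ μ) (rewr {p = p} s L) with Lift-++ μ L
    ... | _ , _ , Lμ , Lν , eq = _ , _ , rewr s Lμ , Lν , trans (cong (p +_) eq) (sym (+-assoc p _ _))

  record RankingFunction (step : Term → MDist → Set) (nf : Term → Set) : Set where
    field
      rank          : Term → ℕ
      nf⇒¬step      : ∀ {t ν} → nf t → ¬ step t ν
      step-nonNeg   : ∀ {t ν} → step t ν → NonNeg ν
      step-mass     : ∀ {t ν} → step t ν → mass ν ≡ 1ℚ
      step-decrease : ∀ {t ν} → step t ν → expectation (fromℕ ∘ rank) ν + 1ℚ ≤ fromℕ (rank t)

  RankingFunction-⊆ : ∀ {step step′ nf} → (∀ {t ν} → step′ t ν → step t ν) →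
                      RankingFunction step nf → RankingFunction step′ nf
  RankingFunction-⊆ ⊆ ρ = record
    { rank = rank ; nf⇒¬step = λ n → nf⇒¬step n ∘ ⊆ ; step-nonNeg = step-nonNeg ∘ ⊆
    ; step-mass = step-mass ∘ ⊆ ; step-decrease = step-decrease ∘ ⊆ }
    where open RankingFunction ρ

  module _ {step nf} (ranking : RankingFunction step nf) where
    open RankingFunction ranking

    expectedRank : MDist → ℚ
    expectedRank = expectation (fromℕ ∘ rank)

    mass-scale-step : ∀ {p t ν} → step t ν → mass (scale p ν) ≡ p
    mass-scale-step {p} {ν = ν} s =
      trans (mass-scale p ν) (trans (cong (p *_) (step-mass s)) (*-identityʳ p))

    Lift-nonNeg : ∀ {μ μ′} → NonNeg μ → Lift step nf μ μ′ → NonNeg μ′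
    Lift-nonNeg nn [] = nn
    Lift-nonNeg (0≤p ∷ nn) (keep _ L) = 0≤p ∷ Lift-nonNeg nn L
    Lift-nonNeg (0≤p ∷ nn) (rewr s L) =
      All.++⁺ (NonNeg-scale 0≤p (step-nonNeg s)) (Lift-nonNeg nn L)

    Lift-mass : ∀ {μ μ′} → Lift step nf μ μ′ → mass μ′ ≡ mass μ
    Lift-mass [] = refl
    Lift-mass (keep {p = p} _ L) = cong (p +_) (Lift-mass L)
    Lift-mass (rewr {p = p} {ν = ν} s L) =
      trans (mass-++ (scale p ν) _) (cong₂ _+_ (mass-scale-step {p} s) (Lift-mass L))

    NFMass+rewrittenMass : ∀ {μ μ′ x} → NFMass nf μ x → (L : Lift step nf μ μ′) →
                           x + rewrittenMass L ≡ mass μ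
    NFMass+rewrittenMass [] [] = refl
    NFMass+rewrittenMass (yes {p = p} {x = x} _ m) (keep _ L) =
      trans (+-assoc p x _) (cong (p +_) (NFMass+rewrittenMass m L))
    NFMass+rewrittenMass (yes n _) (rewr s _) = ⊥-elim (nf⇒¬step n s)
    NFMass+rewrittenMass (no ¬n _) (keep n _) = ⊥-elim (¬n n)
    NFMass+rewrittenMass (no {p = p} {x = x} _ m) (rewr _ L) =
      trans (solve 3 (λ x p r → x :+ (p :+ r) := p :+ (x :+ r)) refl x p (rewrittenMass L))
            (cong (p +_) (NFMass+rewrittenMass m L))

    rewrittenMass-antitone : ∀ {μ μ′ μ″} → NonNeg μ →
                             (L : Lift step nf μ μ′) (L′ : Lift step nf μ′ μ″) →
                             rewrittenMass L′ ≤ rewrittenMass L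
    rewrittenMass-antitone nn [] [] = ≤-refl
    rewrittenMass-antitone (_ ∷ nn) (keep _ L) (keep _ L′) = rewrittenMass-antitone nn L L′
    rewrittenMass-antitone (_ ∷ nn) (keep n _) (rewr s _) = ⊥-elim (nf⇒¬step n s)
    rewrittenMass-antitone (0≤p ∷ nn) (rewr {p = p} {ν = ν} s L) L′ with Lift-++ (scale p ν) L′
    ... | _ , _ , Lν , Lμ , eq = begin
      rewrittenMass L′
        ≡⟨ eq ⟩
      rewrittenMass Lν + rewrittenMass Lμ
        ≤⟨ +-mono-≤ (rewrittenMass≤mass (NonNeg-scale 0≤p (step-nonNeg s)) Lν) (rewrittenMass-antitone nn L Lμ) ⟩
      mass (scale p ν) + rewrittenMass L
        ≡⟨ cong (_+ rewrittenMass L) (mass-scale-step {p} s) ⟩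
      p + rewrittenMass L ∎
      where open ≤-Reasoning

    expectedRank-Lift : ∀ {μ μ′} → NonNeg μ → (L : Lift step nf μ μ′) →
                        expectedRank μ′ + rewrittenMass L ≤ expectedRank μ
    expectedRank-Lift nn [] = ≤-refl
    expectedRank-Lift (_ ∷ nn) (keep {p = p} {t = t} {μ = μ} {μ' = μ′} _ L) = begin
      p * r + expectedRank μ′ + rewrittenMass L     ≡⟨ +-assoc (p * r) (expectedRank μ′) _ ⟩
      p * r + (expectedRank μ′ + rewrittenMass L)   ≤⟨ +-monoʳ-≤ (p * r) (expectedRank-Lift nn L) ⟩
      p * r + expectedRank μ                        ∎
      where open ≤-Reasoning
            r = fromℕ (rank t)
    expectedRank-Lift (0≤p ∷ nn) (rewr {p = p} {t = t} {ν = ν} {μ = μ} {μ' = μ′} s L) = begin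
      expectedRank (scale p ν ++ μ′) + (p + m)
        ≡⟨ cong (_+ (p + m)) (trans (expectation-++ _ (scale p ν) μ′)
                                    (cong (_+ e′) (expectation-scale _ p ν))) ⟩
      p * eν + e′ + (p + m)
        ≡⟨ solve 4 (λ p e f r → p :* e :+ f :+ (p :+ r) := p :* (e :+ con 1ℚ) :+ (f :+ r)) refl p eν e′ m ⟩
      p * (eν + 1ℚ) + (e′ + m)
        ≤⟨ +-mono-≤ (*-monoˡ-≤-nonNeg p {{nonNegative 0≤p}} (step-decrease s)) (expectedRank-Lift nn L) ⟩
      p * fromℕ (rank t) + expectedRank μ ∎
      where open ≤-Reasoning
            m = rewrittenMass L
            eν = expectedRank ν
            e′ = expectedRank μ′

    module RewriteSequence {μs : ℕ → MDist} (steps : ∀ n → Lift step nf (μs n) (μs (suc n)))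
                           {t} (μs₀ : μs 0 ≡ (1ℚ , t) ∷ []) where

      rewrittenAt : ℕ → ℚ
      rewrittenAt n = rewrittenMass (steps n)

      nonNeg-along : ∀ n → NonNeg (μs n)
      nonNeg-along zero = subst NonNeg (sym μs₀) (≤-by-computation ∷ [])
      nonNeg-along (suc n) = Lift-nonNeg (nonNeg-along n) (steps n)

      mass-along : ∀ n → mass (μs n) ≡ 1ℚ
      mass-along zero = cong mass μs₀
      mass-along (suc n) = trans (Lift-mass (steps n)) (mass-along n)

      rewrittenAt-antitone : ∀ n → rewrittenAt (suc n) ≤ rewrittenAt n
      rewrittenAt-antitone n = rewrittenMass-antitone (nonNeg-along n) (steps n) (steps (suc n))

      expectedRank+n*rewrittenAt≤rank : ∀ n →
        expectedRank (μs n) + fromℕ n * rewrittenAt n ≤ fromℕ (rank t)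
      expectedRank+n*rewrittenAt≤rank zero = ≤-reflexive (begin
        expectedRank (μs 0) + 0ℚ * rewrittenAt 0
          ≡⟨ cong₂ _+_ (cong expectedRank μs₀) (*-zeroˡ (rewrittenAt 0)) ⟩
        1ℚ * r + 0ℚ + 0ℚ
          ≡⟨ solve 1 (λ r → con 1ℚ :* r :+ con 0ℚ :+ con 0ℚ := r) refl r ⟩
        r ∎)
        where open ≡-Reasoning
              r = fromℕ (rank t)
      expectedRank+n*rewrittenAt≤rank (suc n) = begin
        e′ + (1ℚ + k) * r′   ≡⟨ solve 3 (λ e k r → e :+ (con 1ℚ :+ k) :* r := e :+ r :+ k :* r) refl e′ k r′ ⟩
        (e′ + r′) + k * r′   ≤⟨ +-mono-≤ (+-monoʳ-≤ e′ r′≤r)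
                                         (*-monoˡ-≤-nonNeg k {{nonNegative (fromℕ-nonNeg n)}} r′≤r) ⟩
        (e′ + r) + k * r     ≤⟨ +-monoˡ-≤ (k * r) (expectedRank-Lift (nonNeg-along n) (steps n)) ⟩
        e + k * r            ≤⟨ expectedRank+n*rewrittenAt≤rank n ⟩
        fromℕ (rank t)       ∎
        where open ≤-Reasoning
              e = expectedRank (μs n)
              e′ = expectedRank (μs (suc n))
              k = fromℕ n
              r = rewrittenAt n
              r′ = rewrittenAt (suc n)
              r′≤r = rewrittenAt-antitone n

      n*rewrittenAt≤rank : ∀ n → fromℕ n * rewrittenAt n ≤ fromℕ (rank t)
      n*rewrittenAt≤rank n = begin
        fromℕ n * rewrittenAt n
          ≡⟨ +-identityˡ _ ⟨
        0ℚ + fromℕ n * rewrittenAt n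
          ≤⟨ +-monoˡ-≤ _ (expectation-nonNeg (fromℕ-nonNeg ∘ rank) (nonNeg-along n)) ⟩
        expectedRank (μs n) + fromℕ n * rewrittenAt n
          ≤⟨ expectedRank+n*rewrittenAt≤rank n ⟩
        fromℕ (rank t) ∎
        where open ≤-Reasoning

      ∣NFMass-1∣≡rewrittenAt : ∀ n {x} → NFMass nf (μs n) x → ∣ x - 1ℚ ∣ ≡ rewrittenAt n
      ∣NFMass-1∣≡rewrittenAt n {x} nfMass = begin
        ∣ x - 1ℚ ∣        ≡⟨ cong (λ z → ∣ x - z ∣) x+r≡1 ⟨
        ∣ x - (x + r) ∣   ≡⟨ cong ∣_∣ (solve 2 (λ x r → x :- (x :+ r) := :- r) refl x r) ⟩
        ∣ - r ∣           ≡⟨ ∣-p∣≡∣p∣ r ⟩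
        ∣ r ∣             ≡⟨ 0≤p⇒∣p∣≡p (rewrittenMass-nonNeg (nonNeg-along n) (steps n)) ⟩
        r                 ∎
        where open ≡-Reasoning
              r = rewrittenAt n
              x+r≡1 : x + r ≡ 1ℚ
              x+r≡1 = trans (NFMass+rewrittenMass nfMass (steps n)) (mass-along n)

    ranking⇒ASTwrt : ASTwrt step nf
    ranking⇒ASTwrt μs t μs₀ steps ε 0<ε = proj₁ eventually , λ n N≤n x nfMass →
      subst (_< ε) (sym (∣NFMass-1∣≡rewrittenAt n nfMass)) (proj₂ eventually n N≤n)
      where
      open RewriteSequence steps μs₀
      eventually = n*x≤C⇒eventually-x<ε rewrittenAt (rank t) n*rewrittenAt≤rank ε 0<ε

-- Chain trees with small leaf probability

module ChainTrees (Σ' : Signature) where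
  open Extended Σ'

  sumℚ-mono-≤ : ∀ {A : Set} {f g : A → ℚ} xs → (∀ x → f x ≤ g x) →
                sumℚ (map f xs) ≤ sumℚ (map g xs)
  sumℚ-mono-≤ [] f≤g = ≤-refl
  sumℚ-mono-≤ (x ∷ xs) f≤g = +-mono-≤ (f≤g x) (sumℚ-mono-≤ xs f≤g)

  sumℚ-*-distribˡ : ∀ {A : Set} c (f : A → ℚ) xs →
                    sumℚ (map (λ x → c * f x) xs) ≡ c * sumℚ (map f xs)
  sumℚ-*-distribˡ c f [] = sym (*-zeroʳ c)
  sumℚ-*-distribˡ c f (x ∷ xs) =
    trans (cong (c * f x +_) (sumℚ-*-distribˡ c f xs)) (sym (*-distribˡ-+ c (f x) _))

  module _ (deg : List ℕ → ℕ) (prob h : List ℕ → ℚ)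
           (prob-nonNeg : ∀ a → 0ℚ ≤ prob a) (h-nonNeg : ∀ a → 0ℚ ≤ h a)
           (h-leaf : ∀ a → deg a ≡ 0 → 1ℚ ≤ h a)
           (h-superharmonic : ∀ a → sumℚ (map (λ i → prob (i ∷ a) * h (i ∷ a)) (upTo (deg a)))
                                    ≤ prob a * h a)
           where

    leafSumAux-≤ : ∀ d a → leafSumAux deg prob d a (deg a) ≤ prob a * h a
    leafSumAux-≤ d a = leafSumAux-≤′ d a (deg a) refl
      where
      leafSumAux-≤′ : ∀ d a k → deg a ≡ k → leafSumAux deg prob d a k ≤ prob a * h a
      leafSumAux-≤′ d a zero deg≡0 = begin
        prob a        ≡⟨ *-identityʳ (prob a) ⟨
        prob a * 1ℚ   ≤⟨ *-monoˡ-≤-nonNeg (prob a) {{nonNegative (prob-nonNeg a)}} (h-leaf a deg≡0) ⟩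
        prob a * h a  ∎
        where open ≤-Reasoning
      leafSumAux-≤′ zero a (suc k) _ = *-nonNeg (prob-nonNeg a) (h-nonNeg a)
      leafSumAux-≤′ (suc d) a (suc k) deg≡1+k = begin
        sumℚ (map (λ i → leafSumAux deg prob d (i ∷ a) (deg (i ∷ a))) (upTo (suc k)))
          ≤⟨ sumℚ-mono-≤ (upTo (suc k)) (λ i → leafSumAux-≤′ d (i ∷ a) (deg (i ∷ a)) refl) ⟩
        sumℚ (map (λ i → prob (i ∷ a) * h (i ∷ a)) (upTo (suc k)))
          ≡⟨ cong (λ n → sumℚ (map (λ i → prob (i ∷ a) * h (i ∷ a)) (upTo n))) deg≡1+k ⟨
        sumℚ (map (λ i → prob (i ∷ a) * h (i ∷ a)) (upTo (deg a)))
          ≤⟨ h-superharmonic a ⟩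
        prob a * h a ∎
        where open ≤-Reasoning

  leafSum-bounded⇒¬iAST-DP : ∀ {P S} (T : ChainTree P S) c → c < 1ℚ →
                             (∀ d → leafSum T d ≤ c) → ¬ iAST-DP P S
  leafSum-bounded⇒¬iAST-DP T c c<1 leafSum≤c iAST = <-irrefl refl (≤-<-trans far (close N ℕ.≤-refl))
    where
    0<1-c : 0ℚ < 1ℚ - c
    0<1-c = begin-strict
      0ℚ      ≡⟨ +-inverseʳ c ⟨
      c - c   <⟨ +-monoˡ-< (- c) c<1 ⟩
      1ℚ - c  ∎
      where open ≤-Reasoning
    N = proj₁ (iAST T (1ℚ - c) 0<1-c)
    close = proj₂ (iAST T (1ℚ - c) 0<1-c)
    x = leafSum T N
    far : 1ℚ - c ≤ ∣ x - 1ℚ ∣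
    far = begin
      1ℚ - c          ≤⟨ +-monoʳ-≤ 1ℚ (neg-antimono-≤ (leafSum≤c N)) ⟩
      1ℚ - x          ≡⟨ solve 1 (λ x → con 1ℚ :- x := :- (x :- con 1ℚ)) refl x ⟩
      - (x - 1ℚ)      ≤⟨ p≤∣p∣ (- (x - 1ℚ)) ⟩
      ∣ - (x - 1ℚ) ∣  ≡⟨ ∣-p∣≡∣p∣ (x - 1ℚ) ⟩
      ∣ x - 1ℚ ∣      ∎
      where open ≤-Reasoning

-- The PTRS R₀ is AST

pattern 𝐟 = zero
pattern 𝐠 = suc zero
pattern 𝐩 = suc (suc zero)
pattern 𝐛 = suc (suc (suc zero))
pattern 𝐝 = suc (suc (suc (suc zero)))

arity₀ : Fin 5 → ℕ
arity₀ 𝐩 = 1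
arity₀ _ = 0

Σ₀ : Signature
Σ₀ = record { nsym = 5 ; arity = arity₀ }

open Generic arity₀

pattern F = fun 𝐟 []
pattern G = fun 𝐠 []
pattern P t = fun 𝐩 (t ∷ [])
pattern B = fun 𝐛 []
pattern D = fun 𝐝 []

⅔ ⅓ : ℚ
⅔ = ℤ.+ 2 / 3
⅓ = ℤ.+ 1 / 3

Rules₀ : List Rule
Rules₀ = F ⇒ ((⅔ , P G) ∷ (⅓ , D) ∷ [])
       ∷ G ⇒ ((1ℚ , F) ∷ [])
       ∷ G ⇒ ((1ℚ , B) ∷ [])
       ∷ P B ⇒ ((1ℚ , F) ∷ [])
       ∷ []

WFRule-deterministic : ∀ {f ts r} → (∀ x → x ∈vars r → x ∈vars fun f ts) →
                       WFRule (fun f ts ⇒ ((1ℚ , r) ∷ []))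
WFRule-deterministic vars = record
  { lhsNotVar = _ , _ , refl ; rhsNonEmpty = λ () ; probPos = <-by-computation ∷ []
  ; probSum = refl ; varCond = vars ∷ [] }

R₀ : PTRS Σ₀
R₀ = record
  { rules = Rules₀
  ; wf = wf-f ∷ WFRule-deterministic (λ { _ (arg () _) }) ∷ WFRule-deterministic (λ { _ (arg () _) })
              ∷ WFRule-deterministic (λ { _ (arg () _) }) ∷ [] }
  where
  wf-f : WFRule (F ⇒ ((⅔ , P G) ∷ (⅓ , D) ∷ []))
  wf-f = record
    { lhsNotVar = _ , _ , refl ; rhsNonEmpty = λ ()
    ; probPos = <-by-computation ∷ <-by-computation ∷ [] ; probSum = refl
    ; varCond = (λ { _ (arg zero (arg () _)) }) ∷ (λ { _ (arg () _) }) ∷ [] }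

-- The constants are chosen for rules-decrease, which at the root reads 7 ≥ ⅔·9 + 1, 8 ≥ 7 + 1,
-- 8 ≥ 0 + 1 and 8 ≥ 7 + 1, as rank₀ (P G) = 9 and rank₀ (P B) = 8.
weight : Term → ℕ
weight G = 1
weight B = 8
weight _ = 0

rank₀ : Term → ℕ
rank₀ (var _) = 0
rank₀ F = 7
rank₀ G = 8
rank₀ (P t) = rank₀ t +ℕ weight t
rank₀ B = 0
rank₀ D = 0

-- Only 𝐩 has an argument and weight vanishes on 𝐩-terms, so the rank of a term depends on its
-- subterm at π only through rankAt π.
rankAt : List ℕ → Term → ℕ
rankAt [] s = rank₀ s
rankAt (_ ∷ _) s = rank₀ s +ℕ weight s

weight-SubAt : ∀ {t i π s} → SubAt t (i ∷ π) s → weight t ≡ 0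
weight-SubAt (arg {f = 𝐩} {ts = _ ∷ []} zero _) = refl

weight-Replace : ∀ {t i π s u} → Replace t (i ∷ π) s u → weight u ≡ 0
weight-Replace (arg {f = 𝐩} {ts = _ ∷ []} zero _) = refl

rank-SubAt : ∀ {t π s} → SubAt t π s → rank₀ t ≡ rankAt π s
rank-SubAt here = refl
rank-SubAt (arg {f = 𝐩} {ts = _ ∷ []} zero here) = refl
rank-SubAt (arg {f = 𝐩} {ts = _ ∷ []} zero sub@(arg _ _)) =
  trans (cong₂ _+ℕ_ (rank-SubAt sub) (weight-SubAt sub)) (ℕ.+-identityʳ _)

rank-Replace : ∀ {t π s u} → Replace t π s u → rank₀ u ≡ rankAt π s
rank-Replace here = refl
rank-Replace (arg {f = 𝐩} {ts = _ ∷ []} zero here) = refl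
rank-Replace (arg {f = 𝐩} {ts = _ ∷ []} zero rep@(arg _ _)) =
  trans (cong₂ _+ℕ_ (rank-Replace rep) (weight-Replace rep)) (ℕ.+-identityʳ _)

instantiate : Subst → List (ℚ × Term) → MDist
instantiate σ = map (map₂ (_⟨ σ ⟩))

expectation-StepRes : ∀ {t π σ rs μ} → Pointwise (StepRes t π σ) rs μ →
  expectation (fromℕ ∘ rank₀) μ ≡ expectation (fromℕ ∘ rankAt π) (instantiate σ rs)
expectation-StepRes [] = refl
expectation-StepRes {rs = (p , _) ∷ _} ((refl , rep) ∷ res) =
  cong₂ (λ k e → p * fromℕ k + e) (rank-Replace rep) (expectation-StepRes res)

rules-decrease : ∀ {ρ} → ρ ∈ Rules₀ → ∀ π σ →
  expectation (fromℕ ∘ rankAt π) (instantiate σ (rhs ρ)) + 1ℚ ≤ fromℕ (rankAt π (lhs ρ ⟨ σ ⟩))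
rules-decrease (here refl)                         []      σ = ≤-by-computation
rules-decrease (here refl)                         (_ ∷ _) σ = ≤-by-computation
rules-decrease (there (here refl))                 []      σ = ≤-by-computation
rules-decrease (there (here refl))                 (_ ∷ _) σ = ≤-by-computation
rules-decrease (there (there (here refl)))         []      σ = ≤-by-computation
rules-decrease (there (there (here refl)))         (_ ∷ _) σ = ≤-by-computation
rules-decrease (there (there (there (here refl)))) []      σ = ≤-by-computation
rules-decrease (there (there (there (here refl)))) (_ ∷ _) σ = ≤-by-computation

ranking₀ : RankingFunction (Step Rules₀) (NF Rules₀)
ranking₀ = record
  { rank = rank₀
  ; nf⇒¬step = λ nf → nf _
  ; step-nonNeg = Step-nonNeg (PTRS.wf R₀)
  ; step-mass = Step-mass (PTRS.wf R₀)
  ; step-decrease = step-decrease }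
  where
  step-decrease : ∀ {t ν} → Step Rules₀ t ν → expectation (fromℕ ∘ rank₀) ν + 1ℚ ≤ fromℕ (rank₀ t)
  step-decrease {t} {ν} st = begin
    expectation (fromℕ ∘ rank₀) ν + 1ℚ
      ≡⟨ cong (_+ 1ℚ) (expectation-StepRes result) ⟩
    expectation (fromℕ ∘ rankAt π) (instantiate σ (rhs ρ)) + 1ℚ
      ≤⟨ rules-decrease ρ∈R π σ ⟩
    fromℕ (rankAt π (lhs ρ ⟨ σ ⟩))
      ≡⟨ cong fromℕ (rank-SubAt redex) ⟨
    fromℕ (rank₀ t) ∎
    where open Step st
          open ≤-Reasoning

AST-R₀ : AST R₀
AST-R₀ = ranking⇒ASTwrt ranking₀

iAST-R₀ : iAST R₀
iAST-R₀ = ranking⇒ASTwrt (RankingFunction-⊆ proj₁ ranking₀)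

-- A chain tree of (DT(R₀), R₀) with leaf probability ½

module E = Extended Σ₀
open ChainTrees Σ₀

S₀ : List E.Rule
S₀ = E.embPTRS R₀

DT₀ : List E.CTuple
DT₀ = E.DT R₀

F♯ G♯ : E.Term
F♯ = E.mark F
G♯ = E.mark G

P♯ : Term → E.Term
P♯ t = E.mark (P t)

NF-of-no-redex : ∀ {t} → (∀ {ρ σ π} → ρ ∈ S₀ → ¬ E.SubAt t π (E.lhs ρ E.⟨ σ ⟩)) → E.NF S₀ t
NF-of-no-redex no-redex _ st = no-redex ρ∈R redex
  where open E.Step st

NF-F♯ : E.NF S₀ F♯
NF-F♯ = NF-of-no-redex λ
  { (here refl)                         (E.arg () _)
  ; (there (here refl))                 (E.arg () _)
  ; (there (there (here refl)))         (E.arg () _)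
  ; (there (there (there (here refl)))) (E.arg () _) }

NF-G♯ : E.NF S₀ G♯
NF-G♯ = NF-of-no-redex λ
  { (here refl)                         (E.arg () _)
  ; (there (here refl))                 (E.arg () _)
  ; (there (there (here refl)))         (E.arg () _)
  ; (there (there (there (here refl)))) (E.arg () _) }

NF-P♯B : E.NF S₀ (P♯ B)
NF-P♯B = NF-of-no-redex λ
  { (here refl)                         (E.arg zero (E.arg () _))
  ; (there (here refl))                 (E.arg zero (E.arg () _))
  ; (there (there (here refl)))         (E.arg zero (E.arg () _))
  ; (there (there (there (here refl)))) (E.arg zero (E.arg () _)) }

-- Defining F♯s through idleF♯ makes the shape field of every P-step below hold by refl.
idleF♯ : ℕ → List (Maybe (List ℕ) × E.Term)
idleF♯ n = replicate n (nothing , F♯)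

F♯s : ℕ → List E.Term
F♯s n = map proj₂ (idleF♯ n)

idleF♯-ArgOut : ∀ {κ σ r} n → Pointwise (E.ArgOut S₀ κ σ r) (idleF♯ n) (F♯s n)
idleF♯-ArgOut zero = []
idleF♯-ArgOut (suc n) = refl ∷ idleF♯-ArgOut n

F♯s-NotComp : ∀ n → All E.NotComp (F♯s n)
F♯s-NotComp zero = []
F♯s-NotComp (suc n) = tt ∷ F♯s-NotComp n

data State : Set where
  walk p♯g p♯b f♯g♯ : ℕ → State

term : State → E.Term
term (walk n) = E.mkComp (F♯s n)
term (p♯g m)  = E.mkComp (P♯ G ∷ G♯ ∷ F♯s m)
term (p♯b m)  = E.mkComp (P♯ B ∷ G♯ ∷ F♯s m)
term (f♯g♯ m) = E.mkComp (F♯ ∷ G♯ ∷ F♯s m)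

degree : State → ℕ
degree (walk zero) = 0
degree (walk (suc n)) = 2
degree _ = 1

next : State → ℕ → State
next (walk zero) _ = walk zero
next (walk (suc n)) zero = p♯g n
next (walk (suc n)) (suc _) = walk n
next (p♯g m) _ = p♯b m
next (p♯b m) _ = f♯g♯ m
next (f♯g♯ m) _ = walk (suc (suc m))

transition : State → ℕ → ℚ
transition (walk (suc n)) zero = ⅔
transition (walk (suc n)) (suc _) = ⅓
transition _ _ = 1ℚ

isP : State → Bool
isP (p♯g _) = false
isP _ = true

isP-next : ∀ s i → isP s ≡ false → isP (next s i) ≡ true
isP-next (p♯g m) i _ = refl

StateNodeOK : State → ℚ → Set
StateNodeOK s p = Σ E.MDist λ μ →
  (if isP s then E.PStep DT₀ S₀ (term s) μ else E.IStep S₀ (term s) μ) ×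
  Pointwise (E.ChildOK p) μ (map (λ i → (p * transition s i , term (next s i))) (upTo (degree s)))

stateNodeOK : ∀ s p → 0 <ℕ degree s → StateNodeOK s p
stateNodeOK (walk (suc n)) p _ = _ , step , (refl , refl) ∷ (refl , refl) ∷ []
  where
  step : E.PStep DT₀ S₀ (term (walk (suc n))) _
  step = record
    { κ∈P = here refl ; σ = E.var ; before = [] ; after = idleF♯ n ; s = F♯
    ; shape = refl ; normalized = tt ∷ F♯s-NotComp n ; sel = refl ; selNF = NF-F♯
    ; result = (refl , [] , F♯s n , [] , idleF♯-ArgOut n , refl)
             ∷ (refl , [] , F♯s n , [] , idleF♯-ArgOut n , refl) ∷ [] }
stateNodeOK (p♯g m) p _ = _ , step , (refl , refl) ∷ []
  where
  step : E.IStep S₀ (term (p♯g m)) _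
  step = record { ρ∈R = there (there (here refl)) ; σ = E.var ; π = 0 ∷ 0 ∷ []
                ; redex = E.arg zero (E.arg zero E.here)
                ; result = (refl , E.arg zero (E.arg zero E.here)) ∷ [] }
       , λ { _ _ E.here π≢[] → ⊥-elim (π≢[] refl) ; _ _ (E.arg () _) _ }
stateNodeOK (p♯b m) p _ = _ , step , (refl , refl) ∷ []
  where
  step : E.PStep DT₀ S₀ (term (p♯b m)) _
  step = record
    { κ∈P = there (there (there (here refl))) ; σ = E.var
    ; before = [] ; after = (nothing , G♯) ∷ idleF♯ m ; s = P♯ B
    ; shape = refl ; normalized = tt ∷ tt ∷ F♯s-NotComp m ; sel = refl ; selNF = NF-P♯B
    ; result = (refl , [] , G♯ ∷ F♯s m , [] , refl ∷ idleF♯-ArgOut m , refl) ∷ [] }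
stateNodeOK (f♯g♯ m) p _ = _ , step , (refl , refl) ∷ []
  where
  step : E.PStep DT₀ S₀ (term (f♯g♯ m)) _
  step = record
    { κ∈P = there (here refl) ; σ = E.var
    ; before = (nothing , F♯) ∷ [] ; after = idleF♯ m ; s = G♯
    ; shape = refl ; normalized = tt ∷ tt ∷ F♯s-NotComp m ; sel = refl ; selNF = NF-G♯
    ; result = (refl , F♯ ∷ [] , F♯s m , refl ∷ [] , idleF♯-ArgOut m , refl) ∷ [] }

stateAt : List ℕ → State
stateAt [] = walk 1
stateAt (i ∷ a) = next (stateAt a) i

probAt : List ℕ → ℚ
probAt [] = 1ℚ
probAt (i ∷ a) = probAt a * transition (stateAt a) i

randomWalkTree : E.ChainTree DT₀ S₀
randomWalkTree = record
  { deg = degree ∘ stateAt ; prob = probAt ; term = term ∘ stateAt ; inP = isP ∘ stateAt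
  ; rootProb = refl
  ; inner = λ a _ → stateNodeOK (stateAt a) (probAt a)
  ; infP = infinitelyOftenP }
  where
  infinitelyOftenP : (path : ℕ → List ℕ) → path 0 ≡ [] →
    (∀ m → Σ ℕ λ i → i <ℕ degree (stateAt (path m)) × path (suc m) ≡ i ∷ path m) →
    ∀ m → Σ ℕ λ m′ → m ≤ℕ m′ × isP (stateAt (path m′)) ≡ true
  infinitelyOftenP path _ child m with isP (stateAt (path m)) in isP≡
  ... | true = m , ℕ.≤-refl , isP≡
  ... | false with child m
  ...   | i , _ , path′≡ =
    suc m , ℕ.n≤1+n m , trans (cong (isP ∘ stateAt) path′≡) (isP-next _ i isP≡)

½^_ : ℕ → ℚ
½^ zero = 1ℚ
½^ suc n = ½ * ½^ n

½^-nonNeg : ∀ n → 0ℚ ≤ ½^ n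
½^-nonNeg zero = ≤-by-computation
½^-nonNeg (suc n) = *-nonNeg {½} ≤-by-computation (½^-nonNeg n)

reach : State → ℚ
reach (walk n) = ½^ n
reach (p♯g m) = ½^ suc (suc m)
reach (p♯b m) = ½^ suc (suc m)
reach (f♯g♯ m) = ½^ suc (suc m)

reach-nonNeg : ∀ s → 0ℚ ≤ reach s
reach-nonNeg (walk n) = ½^-nonNeg n
reach-nonNeg (p♯g m) = ½^-nonNeg (suc (suc m))
reach-nonNeg (p♯b m) = ½^-nonNeg (suc (suc m))
reach-nonNeg (f♯g♯ m) = ½^-nonNeg (suc (suc m))

reach-leaf : ∀ s → degree s ≡ 0 → 1ℚ ≤ reach s
reach-leaf (walk zero) _ = ≤-refl

1*h+0≤h : ∀ h → 1ℚ * h + 0ℚ ≤ h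
1*h+0≤h h = ≤-reflexive (solve 1 (λ h → con 1ℚ :* h :+ con 0ℚ := h) refl h)

reach-superharmonic : ∀ s → E.sumℚ (map (λ i → transition s i * reach (next s i)) (upTo (degree s)))
                            ≤ reach s
reach-superharmonic (walk zero) = ≤-by-computation
reach-superharmonic (walk (suc n)) = ≤-reflexive
  (solve 1 (λ h → con ⅔ :* (con ½ :* (con ½ :* h)) :+ (con ⅓ :* h :+ con 0ℚ) := con ½ :* h) refl (½^ n))
reach-superharmonic (p♯g m) = 1*h+0≤h (reach (p♯b m))
reach-superharmonic (p♯b m) = 1*h+0≤h (reach (f♯g♯ m))
reach-superharmonic (f♯g♯ m) = 1*h+0≤h (reach (f♯g♯ m))

transition-nonNeg : ∀ s i → 0ℚ ≤ transition s i
transition-nonNeg (walk zero) _ = ≤-by-computation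
transition-nonNeg (walk (suc n)) zero = ≤-by-computation
transition-nonNeg (walk (suc n)) (suc _) = ≤-by-computation
transition-nonNeg (p♯g _) _ = ≤-by-computation
transition-nonNeg (p♯b _) _ = ≤-by-computation
transition-nonNeg (f♯g♯ _) _ = ≤-by-computation

probAt-nonNeg : ∀ a → 0ℚ ≤ probAt a
probAt-nonNeg [] = ≤-by-computation
probAt-nonNeg (i ∷ a) = *-nonNeg (probAt-nonNeg a) (transition-nonNeg (stateAt a) i)

leafSum-randomWalkTree : ∀ d → E.leafSum randomWalkTree d ≤ ½
leafSum-randomWalkTree d = ≤-trans
  (leafSumAux-≤ (degree ∘ stateAt) probAt (reach ∘ stateAt) probAt-nonNeg (reach-nonNeg ∘ stateAt)
                (reach-leaf ∘ stateAt) superharmonic d [])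
  ≤-by-computation
  where
  superharmonic : ∀ a → E.sumℚ (map (λ i → probAt (i ∷ a) * reach (stateAt (i ∷ a)))
                                     (upTo (degree (stateAt a))))
                        ≤ probAt a * reach (stateAt a)
  superharmonic a = begin
    E.sumℚ (map (λ i → p * transition s i * reach (next s i)) (upTo (degree s)))
      ≡⟨ cong E.sumℚ (map-cong (λ i → *-assoc p (transition s i) _) (upTo (degree s))) ⟩
    E.sumℚ (map (λ i → p * (transition s i * reach (next s i))) (upTo (degree s)))
      ≡⟨ sumℚ-*-distribˡ p _ (upTo (degree s)) ⟩
    p * E.sumℚ (map (λ i → transition s i * reach (next s i)) (upTo (degree s)))
      ≤⟨ *-monoˡ-≤-nonNeg p {{nonNegative (probAt-nonNeg a)}} (reach-superharmonic s) ⟩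
    p * reach s ∎
    where open ≤-Reasoning
          s = stateAt a
          p = probAt a

¬iAST-DP : ¬ E.iAST-DP DT₀ S₀
¬iAST-DP = leafSum-bounded⇒¬iAST-DP randomWalkTree ½ <-by-computation leafSum-randomWalkTree

lemma3 : Σ Signature λ Σ' → Σ (PTRS Σ') λ R →
    iAST R × AST R × ¬ Extended.iAST-DP Σ' (Extended.DT Σ' R) (Extended.embPTRS Σ' R)
lemma3 = Σ₀ , R₀ , iAST-R₀ , AST-R₀ , ¬iAST-DP
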